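{- Let $G=(V,E)$ be a graph with edge weights $w\in\mathbb{R}^E_{\ge 0}$, let $f$ be its graph coverage function, and let $\mathcal{M}$ be a matroid on $V$ of rank $k\ge 1$. Let $\mathcal{P}$ be the partition returned by the Gomory-Hu tree algorithm run on the cut function $d_w$ and $\mathcal{M}$ (described in the context). Then $\mathcal{P}$ is feasible and $f(\mathcal{P})\le \tfrac{4}{3}\,\mathrm{OPT}$, where $\mathrm{OPT}$ is the minimum of $f(\mathcal{P}')$ over all feasible partitions $\mathcal{P}'$.
   Context: The graph coverage function is $f(S)=\sum_{uv\in E:\{u,v\}\cap S\ne\emptyset} w(uv)$ for $S\subseteq V$; the cut function is $d_w(S)=\sum_{uv\in E: |\{u,v\}\cap S|=1} w(uv)$ (symmetric and submodular). For a partition $\mathcal{P}$, $f(\mathcal{P})=\sum_{X\in\mathcal{P}}f(X)$. A partition $\{V_1,\dots,V_k\}$ of $V$ is feasible if some basis $B$ of $\mathcal{M}$ has $|B\cap V_i|=1$ for all $i$. A Gomory-Hu tree of a symmetric submodular $g$ on $V$ is a tree $H=(V,F)$ with weights $w_H\ge 0$ such that for all distinct $s,t$, the minimum $w_H$-weight on the $s$–$t$ path in $H$ equals $\min\{g(S): s\in S\subseteq V\setminus\{t\}\}$, and the two components of $H$ minus a minimum-weight edge of that path form a minimizer. For a tree $H=(V,F)$ and $\mathcal{M}=(V,\mathcal{I})$, let $\mathcal{I}'$ be the family of $X'\subseteq F$ such that the components $V_1,\dots,V_{|X'|+1}$ of $H-X'$ admit $v_i\in V_i$ with $\{v_1,\dots,v_{|X'|+1}\}\in\mathcal{I}$.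 Gomory-Hu tree algorithm on $(g,\mathcal{M})$: compute a Gomory-Hu tree $(H,w_H)$ of $g$; start with $C=\emptyset$; while $|C|<k-1$, add to $C$ an edge $e\notin C$ with $C\cup\{e\}\in\mathcal{I}'$ of minimum $w_H(e)$; return the components of $(V,F\setminus C)$.
   Formalization: The edge weights $w$ are rational instead of real. -}

module Defs where

open import Data.Nat as ℕ using (ℕ; zero; suc)
open import Data.Fin using (Fin; zero; suc)
open import Data.Fin.Properties using (_≟_; _<?_)
open import Data.Fin.Subset using (Subset; ⊥; ⁅_⁆; _∈_; _∉_; _⊆_; _∪_; ∣_∣)
open import Data.Rational using (ℚ; 0ℚ; _+_; _≤_)
open import Data.Bool using (Bool; true; false; if_then_else_; _∧_; _∨_; _xor_)
open import Data.Vec using (lookup; tabulate)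
open import Data.Product using (_×_; _,_; proj₁; proj₂; ∃)
open import Data.Sum using (_⊎_)
open import Relation.Nullary using (¬_; does)
open import Relation.Binary.PropositionalEquality using (_≡_; _≢_)

sumFin : ∀ {n} → (Fin n → ℚ) → ℚ
sumFin {zero}  f = 0ℚ
sumFin {suc n} f = f zero + sumFin (λ i → f (suc i))

-- Weighted graph on V = Fin n, given by a symmetric weight function
-- w i j on unordered pairs {i,j}, i ≠ j (weight 0 = no edge).

pairSum : ∀ {n} → (Fin n → Fin n → ℚ) → (Fin n → Fin n → Bool) → ℚ
pairSum w P = sumFin λ i → sumFin λ j →
  if does (i <? j) ∧ P i j then w i j else 0ℚ

coverage : ∀ {n} → (Fin n → Fin n → ℚ) → Subset n → ℚ
coverage w S = pairSum w (λ i j → lookup S i ∨ lookup S j)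

cut : ∀ {n} → (Fin n → Fin n → ℚ) → Subset n → ℚ
cut w S = pairSum w (λ i j → lookup S i xor lookup S j)

record Matroid (n : ℕ) : Set₁ where
  field
    Indep    : Subset n → Set
    indep-∅  : Indep ⊥
    indep-⊆  : ∀ {A B} → A ⊆ B → Indep B → Indep A
    exchange : ∀ {A B} → Indep A → Indep B → ∣ A ∣ ℕ.< ∣ B ∣ →
               ∃ λ x → x ∈ B × x ∉ A × Indep (⁅ x ⁆ ∪ A)

open Matroid public

HasRank : ∀ {n} → Matroid n → ℕ → Set
HasRank M k = (∃ λ A → Indep M A × ∣ A ∣ ≡ k) × (∀ A → Indep M A → ∣ A ∣ ℕ.≤ k)

IsBasis : ∀ {n} → Matroid n → Subset n → Set
IsBasis M B = Indep M B × (∀ x → x ∉ B → ¬ Indep M (⁅ x ⁆ ∪ B))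

-- Partitions, represented by a labelling lab : V → Fin p; the parts are
-- V_c = lab⁻¹(c).  A partition has all parts non-empty (lab surjective).

IsPartition : ∀ {n p} → (Fin n → Fin p) → Set
IsPartition {n} {p} lab = ∀ (c : Fin p) → ∃ λ v → lab v ≡ c

part : ∀ {n p} → (Fin n → Fin p) → Fin p → Subset n
part lab c = tabulate (λ v → does (lab v ≟ c))

partCost : ∀ {n p} → (Subset n → ℚ) → (Fin n → Fin p) → ℚ
partCost f lab = sumFin (λ c → f (part lab c))

Feasible : ∀ {n p} → Matroid n → (Fin n → Fin p) → Set
Feasible {n} {p} M lab = ∃ λ B → IsBasis M B ×
  (∀ (c : Fin p) → (∃ λ v → v ∈ B × lab v ≡ c) ×
     (∀ u v → u ∈ B → v ∈ B → lab u ≡ c → lab v ≡ c → u ≡ v))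

-- Trees on Fin n with edge set F = Fin m, edge e joining the two
-- vertices of ends e.  Reach ends X u v : u and v are connected in
-- (V, F ∖ X).

Adj : ∀ {n} → Fin n × Fin n → Fin n → Fin n → Set
Adj (a , b) u v = (a ≡ u × b ≡ v) ⊎ (a ≡ v × b ≡ u)

data Reach {n m : ℕ} (ends : Fin m → Fin n × Fin n) (X : Subset m) :
     Fin n → Fin n → Set where
  here : ∀ {u} → Reach ends X u u
  step : ∀ {u x v} (e : Fin m) → e ∉ X → Adj (ends e) u x →
         Reach ends X x v → Reach ends X u v

IsTree : ∀ {n m} → (Fin m → Fin n × Fin n) → Set
IsTree {n} {m} ends = (suc m ≡ n) × (∀ u v → Reach ends ⊥ u v)

-- edge e lies on the s–t path of the tree iff deleting it separates s,t
OnPath : ∀ {n m} → (Fin m → Fin n × Fin n) → Fin m → Fin n → Fin n → Set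
OnPath ends e s t = ¬ Reach ends ⁅ e ⁆ s t

IsGomoryHu : ∀ {n m} → (Subset n → ℚ) → (Fin m → Fin n × Fin n) →
             (Fin m → ℚ) → Set
IsGomoryHu {n} {m} g ends wH =
  ∀ (s t : Fin n) → s ≢ t → ∀ (e : Fin m) → OnPath ends e s t →
  (∀ e' → OnPath ends e' s t → wH e ≤ wH e') →
  (∀ (S : Subset n) → s ∈ S → t ∉ S → wH e ≤ g S) ×
  (∀ (S : Subset n) → (∀ v → (v ∈ S → Reach ends ⁅ e ⁆ s v) ×
                               (Reach ends ⁅ e ⁆ s v → v ∈ S)) →
     g S ≡ wH e)

IndepI' : ∀ {n m} → Matroid n → (Fin m → Fin n × Fin n) → Subset m → Set
IndepI' M ends X = ∃ λ R → Indep M R ×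
  (∀ v → ∃ λ r → r ∈ R × Reach ends X v r) ×
  (∀ r r' → r ∈ R → r' ∈ R → Reach ends X r r' → r ≡ r')

-- GreedyRun M ends wH C i : C is the edge set after i iterations of the
-- greedy loop of the Gomory-Hu tree algorithm (any tie-breaking).
data GreedyRun {n m : ℕ} (M : Matroid n) (ends : Fin m → Fin n × Fin n)
     (wH : Fin m → ℚ) : Subset m → ℕ → Set where
  start : GreedyRun M ends wH ⊥ zero
  add   : ∀ {C i} (e : Fin m) → GreedyRun M ends wH C i →
          e ∉ C → IndepI' M ends (⁅ e ⁆ ∪ C) →
          (∀ e' → e' ∉ C → IndepI' M ends (⁅ e' ⁆ ∪ C) → wH e ≤ wH e') →
          GreedyRun M ends wH (⁅ e ⁆ ∪ C) (suc i)

IsComponentLabeling : ∀ {n m p} → (Fin m → Fin n × Fin n) → Subset m →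
                      (Fin n → Fin p) → Set
IsComponentLabeling ends C lab = IsPartition lab ×
  (∀ u v → (lab u ≡ lab v → Reach ends C u v) × (Reach ends C u v → lab u ≡ lab v))

{-# OPTIONS --safe #-}
module Submission where

-- Let δ(𝒫) be the weight of the edges joining different parts. Counting each edge once per part it
-- touches gives f(𝒫) = w(E) + δ(𝒫) and Σ_{X ∈ 𝒫} d_w(X) = 2 δ(𝒫). For the output 𝒫 = components of
-- H − C, every edge between parts is cut by the fundamental cut of some e ∈ C, whose weight is w_H(e)
-- by the Gomory–Hu property, so δ(𝒫) ≤ w_H(C). For a feasible 𝒫' with transversal basis B, the
-- Gomory–Hu lower bounds yield tree edges D separating B with w_H(D) ≤ Σ_{X ∈ 𝒫'} d_w(X) = 2 δ(𝒫'),
-- and the matroid exchange axiom makes the greedy choice optimal among such sets: w_H(C) ≤ w_H(D).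
-- Thus δ(𝒫) ≤ min(w(E), 2 δ(𝒫')), whence f(𝒫) ≤ 4/3 f(𝒫'). Feasibility: H − C has k + 1
-- components, each containing exactly one element of an independent set, which is then a basis.

open import Defs
open import Data.Nat using (ℕ; suc)
open import Data.Fin using (Fin)
open import Data.Fin.Subset using (Subset)
open import Data.Integer using (+_)
open import Data.Rational using (ℚ; 0ℚ; _≤_; _*_; _/_)
open import Data.Product using (_×_)
open import Relation.Binary.PropositionalEquality using (_≡_)

open import Algebra.Bundles using (CommutativeMonoid)
open import Data.Bool using (Bool; true; false; _∧_; _∨_; _xor_; not; if_then_else_)
open import Data.Bool.Properties using (∨-identityʳ; xor-identityʳ; ∧-zeroʳ)
open import Data.Empty using (⊥-elim)
open import Data.Fin using (zero; suc)
open import Data.Fin.Properties using (_≟_; _<?_; any?; suc-injective)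
open import Data.Fin.Subset
  using (⊥; ⊤; ⁅_⁆; _∪_; _─_; _-_; _∈_; _∉_; _⊆_; _⊂_; _⊃_; ∣_∣; Empty; ∁; inside; outside)
open import Data.Fin.Subset.Properties
  using (_∈?_; nonempty?; ∉⊥; ⊆-antisym; x∈⁅x⁆; x∈⁅y⁆⇒x≡y; ∣⁅x⁆∣≡1; ∣⊥∣≡0; ∣p∣≤n; ∣⊤∣≡n;
         p⊆q⇒∣p∣≤∣q∣; p⊆p∪q; q⊆p∪q; x∈p∪q⁻; x∈p∪q⁺; ∪-identityˡ; Empty-unique;
         x∈p∧x≢y⇒x∈p-y; x∈p∧x∉q⇒x∈p─q; p─q⊆p; x∈p⇒p-x⊂p; x∉∁p⇒x∈p; x∈∁p⇒x∉p)
open import Data.Fin.Subset.Induction using (⊂-wellFounded; ⊃-wellFounded)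
open import Data.Nat using (zero)
import Data.Nat as ℕ
import Data.Nat.Properties as ℕₚ
open import Data.Rational using (_+_)
import Data.Rational.Properties as ℚₚ
open import Data.Rational.Solver using (module +-*-Solver)
open import Data.Product using (∃; ∃₂; _,_; proj₁; proj₂)
open import Data.Sum using (_⊎_; inj₁; inj₂; [_,_]′)
open import Data.Vec using (_∷_; lookup; tabulate)
open import Data.Vec.Base using (here; there)
open import Data.Vec.Properties using (lookup∘tabulate; []=⇒lookup; lookup⇒[]=)
open import Function using (_∘_)
open import Induction.WellFounded as WF using (Acc; acc)
open import Relation.Nullary using (¬_; Dec; yes; no; does; ¬?)
open import Relation.Nullary.Decidable using (dec-true; decidable-stable; _×-dec_)
open import Relation.Binary.PropositionalEquality
  using (_≢_; refl; sym; trans; cong; cong₂; subst; subst₂; module ≡-Reasoning)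
open import Relation.Unary using (Pred; Decidable)
open import Algebra.Properties.CommutativeSemigroup
  (CommutativeMonoid.commutativeSemigroup ℚₚ.+-0-commutativeMonoid) using (interchange; x∙yz≈y∙xz)

module _ {n p} {P : Pred (Fin n) p} (P? : Decidable P) where

  ∈-tabulate⁺ : ∀ {x} → P x → x ∈ tabulate (does ∘ P?)
  ∈-tabulate⁺ {x} px = lookup⇒[]= x _ (trans (lookup∘tabulate (does ∘ P?) x) (dec-true (P? x) px))

  ∈-tabulate⁻ : ∀ {x} → x ∈ tabulate (does ∘ P?) → P x
  ∈-tabulate⁻ {x} x∈ with P? x | trans (sym (lookup∘tabulate (does ∘ P?) x)) ([]=⇒lookup x∈)
  ... | yes px | _ = px

x∈p─q⇒x∉q : ∀ {n} {p q : Subset n} {x} → x ∈ p ─ q → x ∉ q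
x∈p─q⇒x∉q {p = inside ∷ p}  {outside ∷ q} here      ()
x∈p─q⇒x∉q {p = _ ∷ p}       {_ ∷ q}       (there h) (there h′) = x∈p─q⇒x∉q h h′

x∈p⇒⁅x⁆⊆p : ∀ {n} {p : Subset n} {x} → x ∈ p → ⁅ x ⁆ ⊆ p
x∈p⇒⁅x⁆⊆p {p = p} {x} x∈p y∈x = subst (_∈ p) (sym (x∈⁅y⁆⇒x≡y x y∈x)) x∈p

∪-least : ∀ {n} {p q r : Subset n} → p ⊆ r → q ⊆ r → p ∪ q ⊆ r
∪-least {p = p} {q} p⊆r q⊆r x∈ = [ p⊆r , q⊆r ]′ (x∈p∪q⁻ p q x∈)

x∉p-x : ∀ {n} {p : Subset n} {x} → x ∉ p - x
x∉p-x {x = x} h = x∈p─q⇒x∉q h (x∈⁅x⁆ x)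

⁅x⁆∪[p-x]≡p : ∀ {n} {p : Subset n} {x} → x ∈ p → ⁅ x ⁆ ∪ (p - x) ≡ p
⁅x⁆∪[p-x]≡p {p = p} {x} x∈p = ⊆-antisym
  (∪-least (x∈p⇒⁅x⁆⊆p x∈p) (p─q⊆p p ⁅ x ⁆))
  (λ {y} y∈p → x∈p∪q⁺ (split y∈p (y ≟ x)))
  where
  split : ∀ {y} → y ∈ p → Dec (y ≡ x) → y ∈ ⁅ x ⁆ ⊎ y ∈ p - x
  split _   (yes refl) = inj₁ (x∈⁅x⁆ x)
  split y∈p (no y≢x)   = inj₂ (x∈p∧x≢y⇒x∈p-y y∈p y≢x)

∣⁅x⁆∪p∣≡1+∣p∣ : ∀ {n} {p : Subset n} {x} → x ∉ p → ∣ ⁅ x ⁆ ∪ p ∣ ≡ suc ∣ p ∣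
∣⁅x⁆∪p∣≡1+∣p∣ {p = outside ∷ p} {zero}  x∉p = cong suc (cong ∣_∣ (∪-identityˡ p))
∣⁅x⁆∪p∣≡1+∣p∣ {p = inside ∷ p}  {zero}  x∉p = ⊥-elim (x∉p here)
∣⁅x⁆∪p∣≡1+∣p∣ {p = outside ∷ p} {suc x} x∉p = ∣⁅x⁆∪p∣≡1+∣p∣ (x∉p ∘ there)
∣⁅x⁆∪p∣≡1+∣p∣ {p = inside ∷ p}  {suc x} x∉p = cong suc (∣⁅x⁆∪p∣≡1+∣p∣ (x∉p ∘ there))

∣p∣≡1+∣p-x∣ : ∀ {n} {p : Subset n} {x} → x ∈ p → ∣ p ∣ ≡ suc ∣ p - x ∣
∣p∣≡1+∣p-x∣ {p = p} {x} x∈p = trans (cong ∣_∣ (sym (⁅x⁆∪[p-x]≡p x∈p))) (∣⁅x⁆∪p∣≡1+∣p∣ (x∉p-x {p = p}))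

∣⁅x⁆∪p∣≤1+∣p∣ : ∀ {n} (p : Subset n) x → ∣ ⁅ x ⁆ ∪ p ∣ ℕ.≤ suc ∣ p ∣
∣⁅x⁆∪p∣≤1+∣p∣ p x with x ∈? p
... | no x∉p = ℕₚ.≤-reflexive (∣⁅x⁆∪p∣≡1+∣p∣ x∉p)
... | yes x∈p = ℕₚ.≤-trans (p⊆q⇒∣p∣≤∣q∣ (∪-least (x∈p⇒⁅x⁆⊆p x∈p) (λ y∈p → y∈p))) (ℕₚ.n≤1+n ∣ p ∣)

∣p∣≤1 : ∀ {n} (p : Subset n) → (∀ {x y} → x ∈ p → y ∈ p → x ≡ y) → ∣ p ∣ ℕ.≤ 1
∣p∣≤1 {n} p unique with nonempty? p
... | yes (x , x∈p) = subst (∣ p ∣ ℕ.≤_) (∣⁅x⁆∣≡1 x)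
                        (p⊆q⇒∣p∣≤∣q∣ (λ y∈p → subst (_∈ ⁅ x ⁆) (unique x∈p y∈p) (x∈⁅x⁆ x)))
... | no empty = subst (ℕ._≤ 1) (sym (trans (cong ∣_∣ (Empty-unique empty)) (∣⊥∣≡0 n))) ℕ.z≤n

insert-⊂ : ∀ {n} {p : Subset n} {x} → x ∉ p → p ⊂ ⁅ x ⁆ ∪ p
insert-⊂ {p = p} {x} x∉p = q⊆p∪q ⁅ x ⁆ p , x , p⊆p∪q p (x∈⁅x⁆ x) , x∉p

insert-induction : ∀ {n ℓ} (P : Subset n → Set ℓ) →
                   (∀ p → Empty p → P p) →
                   (∀ p x → x ∉ p → P p → P (⁅ x ⁆ ∪ p)) →
                   ∀ p → P p
insert-induction {ℓ = ℓ} P base extend = WF.All.wfRec ⊂-wellFounded ℓ P go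
  where
  go : ∀ p → WF.WfRec _⊂_ P p → P p
  go p rec with nonempty? p
  ... | no empty = base p empty
  ... | yes (x , x∈p) = subst P (⁅x⁆∪[p-x]≡p x∈p) (extend (p - x) x x∉p-x (rec (x∈p⇒p-x⊂p x∈p)))

delete-induction : ∀ {n ℓ} (P : Subset n → Set ℓ) →
                   (∀ p → (∀ x → x ∈ p) → P p) →
                   (∀ p x → x ∉ p → P (⁅ x ⁆ ∪ p) → P p) →
                   ∀ p → P p
delete-induction {ℓ = ℓ} P base extend = WF.All.wfRec ⊃-wellFounded ℓ P go
  where
  go : ∀ p → WF.WfRec _⊃_ P p → P p
  go p rec with nonempty? (∁ p)
  ... | no full = base p (λ x → x∉∁p⇒x∈p (λ x∈∁p → full (x , x∈∁p)))
  ... | yes (x , x∈∁p) = extend p x (x∈∁p⇒x∉p x∈∁p) (rec (insert-⊂ (x∈∁p⇒x∉p x∈∁p)))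

exchange-─-⊂ : ∀ {n} {R T : Subset n} {r b} → b ∈ T → r ∈ R → r ∉ T → (⁅ b ⁆ ∪ (R - r)) ─ T ⊂ R ─ T
exchange-─-⊂ {R = R} {T} {r} {b} b∈T r∈R r∉T = shrink , r , x∈p∧x∉q⇒x∈p─q r∈R r∉T , r∉
  where
  shrink : (⁅ b ⁆ ∪ (R - r)) ─ T ⊆ R ─ T
  shrink {x} x∈ with x∈p∪q⁻ ⁅ b ⁆ (R - r) (p─q⊆p _ T x∈)
  ... | inj₁ x∈b = ⊥-elim (x∈p─q⇒x∉q x∈ (x∈p⇒⁅x⁆⊆p b∈T x∈b))
  ... | inj₂ x∈R-r = x∈p∧x∉q⇒x∈p─q (p─q⊆p R ⁅ r ⁆ x∈R-r) (x∈p─q⇒x∉q x∈)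
  r∉ : r ∉ (⁅ b ⁆ ∪ (R - r)) ─ T
  r∉ r∈ with x∈p∪q⁻ ⁅ b ⁆ (R - r) (p─q⊆p _ T r∈)
  ... | inj₁ r∈b   = r∉T (x∈p⇒⁅x⁆⊆p b∈T r∈b)
  ... | inj₂ r∈R-r = x∉p-x r∈R-r

keepIf : Bool → ℚ → ℚ
keepIf b x = if b then x else 0ℚ

keepIf-nonneg : ∀ b {x} → 0ℚ ≤ x → 0ℚ ≤ keepIf b x
keepIf-nonneg true  0≤x = 0≤x
keepIf-nonneg false _   = ℚₚ.≤-refl

keepIf≤ : ∀ b {x} → 0ℚ ≤ x → keepIf b x ≤ x
keepIf≤ true  _   = ℚₚ.≤-refl
keepIf≤ false 0≤x = 0≤x

sumFin-cong : ∀ {n} {f g : Fin n → ℚ} → (∀ i → f i ≡ g i) → sumFin f ≡ sumFin g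
sumFin-cong {zero}  f≗g = refl
sumFin-cong {suc n} f≗g = cong₂ _+_ (f≗g zero) (sumFin-cong (f≗g ∘ suc))

sumFin-zero : ∀ n → sumFin {n} (λ _ → 0ℚ) ≡ 0ℚ
sumFin-zero zero    = refl
sumFin-zero (suc n) = cong (_+_ 0ℚ) (sumFin-zero n)

sumFin-+ : ∀ {n} (f g : Fin n → ℚ) → sumFin (λ i → f i + g i) ≡ sumFin f + sumFin g
sumFin-+ {zero}  f g = refl
sumFin-+ {suc n} f g =
  trans (cong (_+_ (f zero + g zero)) (sumFin-+ (f ∘ suc) (g ∘ suc)))
        (interchange (f zero) (g zero) (sumFin (f ∘ suc)) (sumFin (g ∘ suc)))

sumFin-comm : ∀ {a b} (f : Fin a → Fin b → ℚ) →
              sumFin (λ i → sumFin (f i)) ≡ sumFin (λ j → sumFin (λ i → f i j))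
sumFin-comm {zero}  {b} f = sym (sumFin-zero b)
sumFin-comm {suc a} {b} f =
  trans (cong (_+_ (sumFin (f zero))) (sumFin-comm (f ∘ suc)))
        (sym (sumFin-+ (f zero) (λ j → sumFin (λ i → f (suc i) j))))

sumFin-keepIf : ∀ {n} b (f : Fin n → ℚ) → sumFin (λ i → keepIf b (f i)) ≡ keepIf b (sumFin f)
sumFin-keepIf     true  f = refl
sumFin-keepIf {n} false f = sumFin-zero n

sumFin-mono : ∀ {n} {f g : Fin n → ℚ} → (∀ i → f i ≤ g i) → sumFin f ≤ sumFin g
sumFin-mono {zero}  f≤g = ℚₚ.≤-refl
sumFin-mono {suc n} f≤g = ℚₚ.+-mono-≤ (f≤g zero) (sumFin-mono (f≤g ∘ suc))

sumFin-nonneg : ∀ {n} {f : Fin n → ℚ} → (∀ i → 0ℚ ≤ f i) → 0ℚ ≤ sumFin f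
sumFin-nonneg {n} {f} 0≤f = subst (_≤ sumFin f) (sumFin-zero n) (sumFin-mono 0≤f)

≤-sumFin : ∀ {n} {f : Fin n → ℚ} → (∀ i → 0ℚ ≤ f i) → ∀ i → f i ≤ sumFin f
≤-sumFin {suc n} {f} 0≤f zero =
  subst (_≤ sumFin f) (ℚₚ.+-identityʳ (f zero)) (ℚₚ.+-monoʳ-≤ (f zero) (sumFin-nonneg (0≤f ∘ suc)))
≤-sumFin {suc n} {f} 0≤f (suc i) =
  subst (_≤ sumFin f) (ℚₚ.+-identityˡ (f (suc i))) (ℚₚ.+-mono-≤ (0≤f zero) (≤-sumFin (0≤f ∘ suc) i))

sumFin-pick : ∀ {n} (a : Fin n) (f : Fin n → ℚ) → sumFin (λ i → keepIf (does (a ≟ i)) (f i)) ≡ f a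
sumFin-pick {suc n} zero    f = trans (cong (_+_ (f zero)) (sumFin-zero n)) (ℚₚ.+-identityʳ (f zero))
sumFin-pick {suc n} (suc a) f = trans (ℚₚ.+-identityˡ _) (sumFin-pick a (f ∘ suc))

sumOver : ∀ {n} → Subset n → (Fin n → ℚ) → ℚ
sumOver p f = sumFin (λ i → keepIf (lookup p i) (f i))

sumOver-⊥ : ∀ {n} (f : Fin n → ℚ) → sumOver ⊥ f ≡ 0ℚ
sumOver-⊥ {zero}  f = refl
sumOver-⊥ {suc n} f = trans (ℚₚ.+-identityˡ _) (sumOver-⊥ (f ∘ suc))

sumOver-insert : ∀ {n} (f : Fin n → ℚ) {p x} → x ∉ p → sumOver (⁅ x ⁆ ∪ p) f ≡ f x + sumOver p f
sumOver-insert f {outside ∷ p} {zero} x∉p =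
  cong (_+_ (f zero)) (trans (cong (λ q → sumOver q (f ∘ suc)) (∪-identityˡ p)) (sym (ℚₚ.+-identityˡ _)))
sumOver-insert f {inside ∷ p}  {zero}  x∉p = ⊥-elim (x∉p here)
sumOver-insert f {s ∷ p}       {suc x} x∉p =
  trans (cong (_+_ (keepIf s (f zero))) (sumOver-insert (f ∘ suc) (x∉p ∘ there)))
        (x∙yz≈y∙xz (keepIf s (f zero)) (f (suc x)) (sumOver p (f ∘ suc)))

sumOver-nonneg : ∀ {n} (p : Subset n) {f : Fin n → ℚ} → (∀ i → 0ℚ ≤ f i) → 0ℚ ≤ sumOver p f
sumOver-nonneg p 0≤f = sumFin-nonneg (λ i → keepIf-nonneg (lookup p i) (0≤f i))

sumFin-comm₃ : ∀ {a b c} (f : Fin a → Fin b → Fin c → ℚ) →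
               sumFin (λ x → sumFin λ y → sumFin λ z → f x y z) ≡
               sumFin (λ y → sumFin λ z → sumFin λ x → f x y z)
sumFin-comm₃ f =
  trans (sumFin-comm (λ x y → sumFin (f x y))) (sumFin-cong (λ y → sumFin-comm (λ x → f x y)))

count-∨ : ∀ {p} (a b : Fin p) x →
          sumFin (λ c → keepIf (does (a ≟ c) ∨ does (b ≟ c)) x) ≡ x + keepIf (not (does (a ≟ b))) x
count-∨ {suc p} zero    zero    x = cong (_+_ x) (sumFin-zero p)
count-∨ {suc p} zero    (suc b) x = cong (_+_ x) (sumFin-pick b (λ _ → x))
count-∨ {suc p} (suc a) zero    x =
  cong (_+_ x) (trans (sumFin-cong (λ c → cong (λ z → keepIf z x) (∨-identityʳ (does (a ≟ c)))))
                     (sumFin-pick a (λ _ → x)))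
count-∨ {suc p} (suc a) (suc b) x = trans (ℚₚ.+-identityˡ _) (count-∨ a b x)

count-xor : ∀ {p} (a b : Fin p) x →
            sumFin (λ c → keepIf (does (a ≟ c) xor does (b ≟ c)) x) ≡
            keepIf (not (does (a ≟ b))) x + keepIf (not (does (a ≟ b))) x
count-xor {suc p} zero    zero    x = cong (_+_ 0ℚ) (sumFin-zero p)
count-xor {suc p} zero    (suc b) x = cong (_+_ x) (sumFin-pick b (λ _ → x))
count-xor {suc p} (suc a) zero    x =
  cong (_+_ x) (trans (sumFin-cong (λ c → cong (λ z → keepIf z x) (xor-identityʳ (does (a ≟ c)))))
                     (sumFin-pick a (λ _ → x)))
count-xor {suc p} (suc a) (suc b) x = trans (ℚₚ.+-identityˡ _) (count-xor a b x)

lookup-part : ∀ {n p} (lab : Fin n → Fin p) c i → lookup (part lab c) i ≡ does (lab i ≟ c)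
lookup-part lab c = lookup∘tabulate (λ v → does (lab v ≟ c))

module PartitionCost {n : ℕ} (w : Fin n → Fin n → ℚ) where

  totalWeight : ℚ
  totalWeight = pairSum w (λ _ _ → true)

  differentParts : ∀ {p} → (Fin n → Fin p) → Fin n → Fin n → Bool
  differentParts lab i j = not (does (lab i ≟ lab j))

  crossingWeight : ∀ {p} → (Fin n → Fin p) → ℚ
  crossingWeight lab = pairSum w (differentParts lab)

  sumFin-pairSum : ∀ {p} (P : Fin p → Fin n → Fin n → Bool) (Q R : Fin n → Fin n → Bool) →
                   (∀ i j x → sumFin (λ c → keepIf (P c i j) x) ≡ keepIf (Q i j) x + keepIf (R i j) x) →
                   sumFin (λ c → pairSum w (P c)) ≡ pairSum w Q + pairSum w R
  sumFin-pairSum {p} P Q R count = begin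
    sumFin (λ c → sumFin λ i → sumFin λ j → term (P c) i j)
      ≡⟨ sumFin-comm₃ (λ c → term (P c)) ⟩
    sumFin (λ i → sumFin λ j → sumFin λ c → term (P c) i j)
      ≡⟨ sumFin-cong (λ i → sumFin-cong (per-pair i)) ⟩
    sumFin (λ i → sumFin λ j → term Q i j + term R i j)
      ≡⟨ sumFin-cong (λ i → sumFin-+ (term Q i) (term R i)) ⟩
    sumFin (λ i → sumFin (term Q i) + sumFin (term R i))
      ≡⟨ sumFin-+ (sumFin ∘ term Q) (sumFin ∘ term R) ⟩
    pairSum w Q + pairSum w R ∎
    where
    open ≡-Reasoning
    term : (Fin n → Fin n → Bool) → Fin n → Fin n → ℚ
    term P i j = keepIf (does (i <? j) ∧ P i j) (w i j)
    per-pair : ∀ i j → sumFin (λ c → keepIf (does (i <? j) ∧ P c i j) (w i j)) ≡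
                       keepIf (does (i <? j) ∧ Q i j) (w i j) + keepIf (does (i <? j) ∧ R i j) (w i j)
    per-pair i j with does (i <? j)
    ... | true  = count i j (w i j)
    ... | false = trans (sumFin-zero p) (sym (ℚₚ.+-identityˡ 0ℚ))

  partCost-coverage : ∀ {p} (lab : Fin n → Fin p) →
                      partCost (coverage w) lab ≡ totalWeight + crossingWeight lab
  partCost-coverage lab = sumFin-pairSum (λ c i j → lookup (part lab c) i ∨ lookup (part lab c) j)
                                         (λ _ _ → true) (differentParts lab) (λ i j x →
    trans (sumFin-cong (λ c → cong₂ (λ a b → keepIf (a ∨ b) x)
                                    (lookup-part lab c i) (lookup-part lab c j)))
          (count-∨ (lab i) (lab j) x))

  sumFin-cut-part : ∀ {p} (lab : Fin n → Fin p) →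
                    sumFin (λ c → cut w (part lab c)) ≡ crossingWeight lab + crossingWeight lab
  sumFin-cut-part lab = sumFin-pairSum (λ c i j → lookup (part lab c) i xor lookup (part lab c) j)
                                       (differentParts lab) (differentParts lab) (λ i j x →
    trans (sumFin-cong (λ c → cong₂ (λ a b → keepIf (a xor b) x)
                                    (lookup-part lab c i) (lookup-part lab c j)))
          (count-xor (lab i) (lab j) x))

  module _ (w≥0 : ∀ i j → 0ℚ ≤ w i j) where

    pairSum-nonneg : ∀ P → 0ℚ ≤ pairSum w P
    pairSum-nonneg P = sumFin-nonneg (λ i → sumFin-nonneg (λ j → keepIf-nonneg _ (w≥0 i j)))

    crossingWeight≤totalWeight : ∀ {p} (lab : Fin n → Fin p) → crossingWeight lab ≤ totalWeight
    crossingWeight≤totalWeight lab = sumFin-mono (λ i → sumFin-mono (λ j → pair i j))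
      where
      pair : ∀ i j → keepIf (does (i <? j) ∧ not (does (lab i ≟ lab j))) (w i j) ≤
                     keepIf (does (i <? j) ∧ true) (w i j)
      pair i j with does (i <? j)
      ... | true  = keepIf≤ _ (w≥0 i j)
      ... | false = ℚₚ.≤-refl

    crossingWeight≤sumOver-cut : ∀ {m p} (lab : Fin n → Fin p) (C : Subset m) (S : Fin m → Subset n) →
      (∀ i j → lab i ≢ lab j → ∃ λ e → e ∈ C × (lookup (S e) i xor lookup (S e) j) ≡ true) →
      crossingWeight lab ≤ sumOver C (λ e → cut w (S e))
    crossingWeight≤sumOver-cut lab C S separated = begin
      crossingWeight lab
        ≤⟨ sumFin-mono (λ i → sumFin-mono (λ j → pair i j)) ⟩
      sumFin (λ i → sumFin λ j → sumFin λ e → G e i j)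
        ≡⟨ sym (sumFin-comm₃ G) ⟩
      sumFin (λ e → sumFin λ i → sumFin λ j → G e i j)
        ≡⟨ sumFin-cong (λ e → trans (sumFin-cong (λ i → sumFin-keepIf (lookup C e) (H e i)))
                                    (sumFin-keepIf (lookup C e) (λ i → sumFin (H e i)))) ⟩
      sumOver C (λ e → cut w (S e)) ∎
      where
      open ℚₚ.≤-Reasoning
      H : Fin _ → Fin n → Fin n → ℚ
      H e i j = keepIf (does (i <? j) ∧ (lookup (S e) i xor lookup (S e) j)) (w i j)
      G : Fin _ → Fin n → Fin n → ℚ
      G e i j = keepIf (lookup C e) (H e i j)
      G≥0 : ∀ i j e → 0ℚ ≤ G e i j
      G≥0 i j e = keepIf-nonneg (lookup C e) (keepIf-nonneg (does (i <? j) ∧ _) (w≥0 i j))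
      pair : ∀ i j → keepIf (does (i <? j) ∧ not (does (lab i ≟ lab j))) (w i j) ≤ sumFin (λ e → G e i j)
      pair i j with lab i ≟ lab j
      ... | yes _ rewrite ∧-zeroʳ (does (i <? j)) = sumFin-nonneg (G≥0 i j)
      ... | no lab≢ with separated i j lab≢
      ...   | e , e∈C , cut-ij with ≤-sumFin (G≥0 i j) e
      ...     | G≤ rewrite []=⇒lookup e∈C | cut-ij = G≤

module _ {n} (M : Matroid n) {r} (rank : HasRank M r) where

  basis-size : ∀ {B} → IsBasis M B → r ℕ.≤ ∣ B ∣
  basis-size {B} (indB , maximal) with proj₁ rank
  ... | A , indA , ∣A∣≡r = ℕₚ.≮⇒≥ λ ∣B∣<r →
    let x , _ , x∉B , indxB = exchange M indB indA (subst (∣ B ∣ ℕ.<_) (sym ∣A∣≡r) ∣B∣<r)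
    in maximal x x∉B indxB

  large-independent-is-basis : ∀ {B} → Indep M B → r ℕ.≤ ∣ B ∣ → IsBasis M B
  large-independent-is-basis {B} indB r≤∣B∣ = indB , λ x x∉B indxB →
    ℕₚ.<-irrefl refl (ℕₚ.≤-trans (ℕ.s≤s r≤∣B∣)
      (subst (ℕ._≤ r) (∣⁅x⁆∪p∣≡1+∣p∣ x∉B) (proj₂ rank (⁅ x ⁆ ∪ B) indxB)))

nonloop : ∀ {n} (M : Matroid n) {r} → HasRank M (suc r) → ∃ λ x → Indep M (⁅ x ⁆ ∪ ⊥)
nonloop {n} M ((A , indA , ∣A∣≡1+r) , _)
  with exchange M (indep-∅ M) indA (subst₂ ℕ._<_ (sym (∣⊥∣≡0 n)) (sym ∣A∣≡1+r) (ℕ.s≤s ℕ.z≤n))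
... | x , _ , _ , indx = x , indx

Adj-sym : ∀ {n} {p : Fin n × Fin n} {u v} → Adj p u v → Adj p v u
Adj-sym (inj₁ (a≡u , b≡v)) = inj₂ (a≡u , b≡v)
Adj-sym (inj₂ (a≡v , b≡u)) = inj₁ (a≡v , b≡u)

Adj-unique : ∀ {n} {p : Fin n × Fin n} {x y x′ y′} → Adj p x y → Adj p x′ y′ →
             (x′ ≡ x × y′ ≡ y) ⊎ (x′ ≡ y × y′ ≡ x)
Adj-unique (inj₁ (refl , refl)) (inj₁ (refl , refl)) = inj₁ (refl , refl)
Adj-unique (inj₁ (refl , refl)) (inj₂ (refl , refl)) = inj₂ (refl , refl)
Adj-unique (inj₂ (refl , refl)) (inj₁ (refl , refl)) = inj₂ (refl , refl)
Adj-unique (inj₂ (refl , refl)) (inj₂ (refl , refl)) = inj₁ (refl , refl)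

∉-insert : ∀ {m} {X : Subset m} {e d} → d ≢ e → d ∉ X → d ∉ ⁅ e ⁆ ∪ X
∉-insert {X = X} {e} d≢e d∉X d∈ with x∈p∪q⁻ ⁅ e ⁆ X d∈
... | inj₁ d∈e = d≢e (x∈⁅y⁆⇒x≡y e d∈e)
... | inj₂ d∈X = d∉X d∈X

module Reachability {n m : ℕ} (ends : Fin m → Fin n × Fin n) where

  Reach-trans : ∀ {X u x v} → Reach ends X u x → Reach ends X x v → Reach ends X u v
  Reach-trans here             x~v = x~v
  Reach-trans (step e e∉ a u~) x~v = step e e∉ a (Reach-trans u~ x~v)

  Reach-sym : ∀ {X u v} → Reach ends X u v → Reach ends X v u
  Reach-sym here             = here
  Reach-sym (step e e∉ a x~v) = Reach-trans (Reach-sym x~v) (step e e∉ (Adj-sym a) here)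

  Reach-mono : ∀ {X Y u v} → Y ⊆ X → Reach ends X u v → Reach ends Y u v
  Reach-mono Y⊆X here             = here
  Reach-mono Y⊆X (step e e∉ a x~v) = step e (e∉ ∘ Y⊆X) a (Reach-mono Y⊆X x~v)

  Reach-single : ∀ {X e u v} → e ∈ X → Reach ends X u v → Reach ends ⁅ e ⁆ u v
  Reach-single e∈X = Reach-mono (x∈p⇒⁅x⁆⊆p e∈X)

  Reach-restore : ∀ {X e u v} → Reach ends (⁅ e ⁆ ∪ X) u v → Reach ends X u v
  Reach-restore {X} {e} = Reach-mono (q⊆p∪q ⁅ e ⁆ X)

  Reach-all⇒≡ : ∀ {X u v} → (∀ e → e ∈ X) → Reach ends X u v → u ≡ v
  Reach-all⇒≡ all here             = refl
  Reach-all⇒≡ all (step e e∉ _ _) = ⊥-elim (e∉ (all e))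

  ViaEdge : Subset m → Fin m → Fin n → Fin n → Set
  ViaEdge X e u v = ∃₂ λ x y → Adj (ends e) x y × Reach ends X u x × Reach ends X y v

  Reach-split : ∀ {X e u v} → e ∉ X → Reach ends X u v →
                Reach ends (⁅ e ⁆ ∪ X) u v ⊎ ViaEdge (⁅ e ⁆ ∪ X) e u v
  Reach-split e∉X here = inj₁ here
  Reach-split {e = e} {u} e∉X (step {x = x₁} d d∉X ux₁ x₁~v) with d ≟ e | Reach-split e∉X x₁~v
  ... | no d≢e | inj₁ x₁~v′ = inj₁ (step d (∉-insert d≢e d∉X) ux₁ x₁~v′)
  ... | no d≢e | inj₂ (x , y , xy , x₁~x , y~v) =
    inj₂ (x , y , xy , step d (∉-insert d≢e d∉X) ux₁ x₁~x , y~v)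
  ... | yes refl | inj₁ x₁~v′ = inj₂ (u , x₁ , ux₁ , here , x₁~v′)
  ... | yes refl | inj₂ (x , y , xy , _ , y~v) with Adj-unique ux₁ xy
  ...   | inj₁ (refl , refl) = inj₂ (x , y , xy , here , y~v)
  ...   | inj₂ (_ , refl)    = inj₁ y~v

  ViaEdge⇒Reach : ∀ {X e u v} → e ∉ X → ViaEdge (⁅ e ⁆ ∪ X) e u v → Reach ends X u v
  ViaEdge⇒Reach e∉X (x , y , xy , u~x , y~v) =
    Reach-trans (Reach-restore u~x) (step _ e∉X xy (Reach-restore y~v))

  Reach? : ∀ X u v → Dec (Reach ends X u v)
  Reach? = delete-induction (λ X → ∀ u v → Dec (Reach ends X u v)) all-deleted delete
    where
    all-deleted : ∀ X → (∀ e → e ∈ X) → ∀ u v → Dec (Reach ends X u v)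
    all-deleted X all u v with u ≟ v
    ... | yes refl = yes here
    ... | no u≢v   = no (u≢v ∘ Reach-all⇒≡ all)
    delete : ∀ X e → e ∉ X → (∀ u v → Dec (Reach ends (⁅ e ⁆ ∪ X) u v)) → ∀ u v → Dec (Reach ends X u v)
    delete X e e∉X Reach′? u v
      with Reach′? u v | Reach′? u (proj₁ (ends e)) ×-dec Reach′? (proj₂ (ends e)) v
                       | Reach′? u (proj₂ (ends e)) ×-dec Reach′? (proj₁ (ends e)) v
    ... | yes u~v | _ | _ = yes (Reach-restore u~v)
    ... | no _ | yes (u~a , b~v) | _ = yes (ViaEdge⇒Reach e∉X (_ , _ , inj₁ (refl , refl) , u~a , b~v))
    ... | no _ | no _ | yes (u~b , a~v) = yes (ViaEdge⇒Reach e∉X (_ , _ , inj₂ (refl , refl) , u~b , a~v))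
    ... | no ¬u~v | no ¬ab | no ¬ba = no (refute ∘ Reach-split e∉X)
      where
      refute : ¬ (Reach ends (⁅ e ⁆ ∪ X) u v ⊎ ViaEdge (⁅ e ⁆ ∪ X) e u v)
      refute (inj₁ u~v′) = ¬u~v u~v′
      refute (inj₂ (_ , _ , inj₁ (refl , refl) , u~x , y~v)) = ¬ab (u~x , y~v)
      refute (inj₂ (_ , _ , inj₂ (refl , refl) , u~x , y~v)) = ¬ba (u~x , y~v)

  Covering : Subset m → Subset n → Set
  Covering X S = ∀ v → ∃ λ r → r ∈ S × Reach ends X v r

  Separated : Subset m → Subset n → Set
  Separated X A = ∀ u v → u ∈ A → v ∈ A → Reach ends X u v → u ≡ v

  Separated-⊆ : ∀ {X A A′} → A′ ⊆ A → Separated X A → Separated X A′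
  Separated-⊆ A′⊆A sep u v u∈ v∈ = sep u v (A′⊆A u∈) (A′⊆A v∈)

  Separated-mono : ∀ {X Y A} → X ⊆ Y → Separated X A → Separated Y A
  Separated-mono X⊆Y sep u v u∈ v∈ u~v = sep u v u∈ v∈ (Reach-mono X⊆Y u~v)

  endpoint-covered : ∀ {X S e} → e ∉ X → Covering X S →
                     ∃₂ λ z z′ → Adj (ends e) z z′ × ∃ λ r → r ∈ S × Reach ends (⁅ e ⁆ ∪ X) z r
  endpoint-covered {e = e} e∉X cover with cover (proj₁ (ends e))
  ... | r , r∈S , a~r with Reach-split e∉X a~r
  ...   | inj₁ a~r′                  = _ , _ , inj₁ (refl , refl) , r , r∈S , a~r′
  ...   | inj₂ (x , y , xy , _ , y~r) = y , x , Adj-sym xy , r , r∈S , y~r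

  covering-insert : ∀ {X S e} → e ∉ X → Covering X S → ∃ λ z → Covering (⁅ e ⁆ ∪ X) (⁅ z ⁆ ∪ S)
  covering-insert {X} {S} {e} e∉X cover with endpoint-covered e∉X cover
  ... | z , z′ , zz′ , r , r∈S , z~r = z′ , cover′
    where
    cover′ : Covering (⁅ e ⁆ ∪ X) (⁅ z′ ⁆ ∪ S)
    cover′ v with cover v
    ... | r′ , r′∈S , v~r′ with Reach-split e∉X v~r′
    ...   | inj₁ v~r′′ = r′ , q⊆p∪q ⁅ z′ ⁆ S r′∈S , v~r′′
    ...   | inj₂ (x , y , xy , v~x , _) with Adj-unique zz′ xy
    ...     | inj₁ (refl , _) = r , q⊆p∪q ⁅ z′ ⁆ S r∈S , Reach-trans v~x z~r
    ...     | inj₂ (refl , _) = x , p⊆p∪q S (x∈⁅x⁆ x) , v~x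

  -- That is, H − X has at least n − m + ∣ X ∣ components.
  covering-size : ∀ X S → Covering X S → n ℕ.+ ∣ X ∣ ℕ.≤ ∣ S ∣ ℕ.+ m
  covering-size =
    delete-induction (λ X → ∀ S → Covering X S → n ℕ.+ ∣ X ∣ ℕ.≤ ∣ S ∣ ℕ.+ m) all-deleted delete
    where
    all-deleted : ∀ X → (∀ e → e ∈ X) → ∀ S → Covering X S → n ℕ.+ ∣ X ∣ ℕ.≤ ∣ S ∣ ℕ.+ m
    all-deleted X all S cover = ℕₚ.+-mono-≤ n≤∣S∣ (∣p∣≤n X)
      where
      n≤∣S∣ : n ℕ.≤ ∣ S ∣
      n≤∣S∣ = subst (ℕ._≤ ∣ S ∣) (∣⊤∣≡n n) (p⊆q⇒∣p∣≤∣q∣ {p = ⊤} (λ {v} _ → represented (cover v)))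
        where
        represented : ∀ {v} → (∃ λ r → r ∈ S × Reach ends X v r) → v ∈ S
        represented (r , r∈S , v~r) = subst (_∈ S) (sym (Reach-all⇒≡ all v~r)) r∈S
    delete : ∀ X e → e ∉ X → (∀ S → Covering (⁅ e ⁆ ∪ X) S → n ℕ.+ ∣ ⁅ e ⁆ ∪ X ∣ ℕ.≤ ∣ S ∣ ℕ.+ m) →
             ∀ S → Covering X S → n ℕ.+ ∣ X ∣ ℕ.≤ ∣ S ∣ ℕ.+ m
    delete X e e∉X size S cover with covering-insert e∉X cover
    ... | z , cover′ = ℕₚ.≤-pred (begin
      suc (n ℕ.+ ∣ X ∣)       ≡⟨ sym (ℕₚ.+-suc n ∣ X ∣) ⟩
      n ℕ.+ suc ∣ X ∣         ≡⟨ cong (n ℕ.+_) (sym (∣⁅x⁆∪p∣≡1+∣p∣ e∉X)) ⟩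
      n ℕ.+ ∣ ⁅ e ⁆ ∪ X ∣     ≤⟨ size (⁅ z ⁆ ∪ S) cover′ ⟩
      ∣ ⁅ z ⁆ ∪ S ∣ ℕ.+ m     ≤⟨ ℕₚ.+-monoˡ-≤ m (∣⁅x⁆∪p∣≤1+∣p∣ S z) ⟩
      suc (∣ S ∣ ℕ.+ m)       ∎)
      where open ℕₚ.≤-Reasoning

  -- Restoring e only merges the components of its two ends, so at most one element of A, the one
  -- sharing a component with the first end, has to go.
  separated-delete : ∀ {X A e} → e ∉ X → Separated (⁅ e ⁆ ∪ X) A →
                     ∃ λ A′ → A′ ⊆ A × Separated X A′ × ∣ A ∣ ℕ.≤ suc ∣ A′ ∣
  separated-delete {X} {A} {e} e∉X sep
    with any? (λ r → r ∈? A ×-dec Reach? (⁅ e ⁆ ∪ X) r (proj₁ (ends e)))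
  ... | yes (r , r∈A , r~a) = A - r , A-r⊆A , sep′ , ℕₚ.≤-reflexive (∣p∣≡1+∣p-x∣ r∈A)
    where
    A-r⊆A : A - r ⊆ A
    A-r⊆A = p─q⊆p A ⁅ r ⁆
    ¬reaches-a : ∀ {u} → u ∈ A - r → ¬ Reach ends (⁅ e ⁆ ∪ X) u (proj₁ (ends e))
    ¬reaches-a {u} u∈ u~a with sep u r (A-r⊆A u∈) r∈A (Reach-trans u~a (Reach-sym r~a))
    ... | refl = x∉p-x u∈
    sep′ : Separated X (A - r)
    sep′ u v u∈ v∈ u~v with Reach-split e∉X u~v
    ... | inj₁ u~v′ = Separated-⊆ A-r⊆A sep u v u∈ v∈ u~v′
    ... | inj₂ (_ , _ , inj₁ (refl , refl) , u~a , _) = ⊥-elim (¬reaches-a u∈ u~a)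
    ... | inj₂ (_ , _ , inj₂ (refl , refl) , _ , a~v) = ⊥-elim (¬reaches-a v∈ (Reach-sym a~v))
  ... | no none = A , (λ u∈ → u∈) , sep′ , ℕₚ.n≤1+n ∣ A ∣
    where
    sep′ : Separated X A
    sep′ u v u∈ v∈ u~v with Reach-split e∉X u~v
    ... | inj₁ u~v′ = sep u v u∈ v∈ u~v′
    ... | inj₂ (_ , _ , inj₁ (refl , refl) , u~a , _) = ⊥-elim (none (u , u∈ , u~a))
    ... | inj₂ (_ , _ , inj₂ (refl , refl) , _ , a~v) = ⊥-elim (none (v , v∈ , Reach-sym a~v))

  Crosses : Subset n → Fin m → Set
  Crosses U d = ∃₂ λ x y → Adj (ends d) x y × x ∈ U × y ∉ U

  crosses? : ∀ U d → Dec (Crosses U d)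
  crosses? U d with proj₁ (ends d) ∈? U | proj₂ (ends d) ∈? U
  ... | yes a∈ | no b∉  = yes (_ , _ , inj₁ (refl , refl) , a∈ , b∉)
  ... | no a∉  | yes b∈ = yes (_ , _ , inj₂ (refl , refl) , b∈ , a∉)
  ... | yes a∈ | yes b∈ = no λ { (_ , _ , inj₁ (refl , refl) , _ , b∉) → b∉ b∈
                               ; (_ , _ , inj₂ (refl , refl) , _ , a∉) → a∉ a∈ }
  ... | no a∉  | no b∉  = no λ { (_ , _ , inj₁ (refl , refl) , a∈ , _) → a∉ a∈
                               ; (_ , _ , inj₂ (refl , refl) , b∈ , _) → b∉ b∈ }

  Reach-stays-inside : ∀ {Y U u v} → (∀ d → Crosses U d → d ∈ Y) → u ∈ U → Reach ends Y u v → v ∈ U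
  Reach-stays-inside crossing∈Y u∈U here = u∈U
  Reach-stays-inside {U = U} crossing∈Y u∈U (step d d∉Y ux x~v) with _ ∈? U
  ... | yes x∈U = Reach-stays-inside crossing∈Y x∈U x~v
  ... | no x∉U  = ⊥-elim (d∉Y (crossing∈Y d (_ , _ , ux , u∈U , x∉U)))

  Separated-insert : ∀ {X A b} → Separated X A → (∀ {v} → v ∈ A → ¬ Reach ends X b v) →
                     Separated X (⁅ b ⁆ ∪ A)
  Separated-insert {X} {A} {b} sep b-alone u v u∈ v∈ u~v with x∈p∪q⁻ ⁅ b ⁆ A u∈ | x∈p∪q⁻ ⁅ b ⁆ A v∈
  ... | inj₁ u∈b | inj₁ v∈b = trans (x∈⁅y⁆⇒x≡y b u∈b) (sym (x∈⁅y⁆⇒x≡y b v∈b))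
  ... | inj₁ u∈b | inj₂ v∈A =
    ⊥-elim (b-alone v∈A (subst (λ x → Reach ends X x v) (x∈⁅y⁆⇒x≡y b u∈b) u~v))
  ... | inj₂ u∈A | inj₁ v∈b =
    ⊥-elim (b-alone u∈A (subst (λ x → Reach ends X x u) (x∈⁅y⁆⇒x≡y b v∈b) (Reach-sym u~v)))
  ... | inj₂ u∈A | inj₂ v∈A = sep u v u∈A v∈A u~v

  -- IndepI' M ends X unfolds to ∃ λ R → Indep M R × Transversal X R.
  Transversal : Subset m → Subset n → Set
  Transversal X R = Covering X R × Separated X R

  transversal-swap : ∀ {C R r b} → Transversal C R → r ∈ R → Reach ends C b r →
                     Transversal C (⁅ b ⁆ ∪ (R - r))
  transversal-swap {C} {R} {r} {b} (cover , sep) r∈R b~r =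
    cover′ , Separated-insert (Separated-⊆ R-r⊆R sep) b-alone
    where
    R-r⊆R : R - r ⊆ R
    R-r⊆R = p─q⊆p R ⁅ r ⁆
    cover′ : Covering C (⁅ b ⁆ ∪ (R - r))
    cover′ v with cover v
    ... | r′ , r′∈R , v~r′ with r′ ≟ r
    ...   | yes refl = b , p⊆p∪q (R - r) (x∈⁅x⁆ b) , Reach-trans v~r′ (Reach-sym b~r)
    ...   | no r′≢r  = r′ , q⊆p∪q ⁅ b ⁆ (R - r) (x∈p∧x≢y⇒x∈p-y r′∈R r′≢r) , v~r′
    b-alone : ∀ {v} → v ∈ R - r → ¬ Reach ends C b v
    b-alone {v} v∈ b~v with sep r v r∈R (R-r⊆R v∈) (Reach-trans (Reach-sym b~r) b~v)
    ... | refl = x∉p-x v∈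

  transversal-split : ∀ {C R r b d} → Transversal C R → r ∈ R → Reach ends C b r → ¬ Reach ends ⁅ d ⁆ r b →
                      d ∉ C × Transversal (⁅ d ⁆ ∪ C) (⁅ b ⁆ ∪ R)
  transversal-split {C} {R} {r} {b} {d} (cover , sep) r∈R b~r ¬r~b =
    d∉C , cover′ , Separated-insert (Separated-mono (q⊆p∪q ⁅ d ⁆ C) sep) b-alone
    where
    d∉C : d ∉ C
    d∉C d∈C = ¬r~b (Reach-single d∈C (Reach-sym b~r))
    ¬r~b′ : ¬ Reach ends (⁅ d ⁆ ∪ C) r b
    ¬r~b′ = ¬r~b ∘ Reach-mono (p⊆p∪q C)
    endpoint-reaches : ∀ {x y} → Adj (ends d) x y → Reach ends (⁅ d ⁆ ∪ C) x r ⊎ Reach ends (⁅ d ⁆ ∪ C) x b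
    endpoint-reaches xy with Reach-split d∉C (Reach-sym b~r)
    ... | inj₁ r~b = ⊥-elim (¬r~b′ r~b)
    ... | inj₂ (x′ , y′ , x′y′ , r~x′ , y′~b) with Adj-unique x′y′ xy
    ...   | inj₁ (refl , _) = inj₁ (Reach-sym r~x′)
    ...   | inj₂ (refl , _) = inj₂ y′~b
    cover′ : Covering (⁅ d ⁆ ∪ C) (⁅ b ⁆ ∪ R)
    cover′ v with cover v
    ... | r′ , r′∈R , v~r′ with Reach-split d∉C v~r′
    ...   | inj₁ v~r′′ = r′ , q⊆p∪q ⁅ b ⁆ R r′∈R , v~r′′
    ...   | inj₂ (x , y , xy , v~x , _) with endpoint-reaches xy
    ...     | inj₁ x~r = r , q⊆p∪q ⁅ b ⁆ R r∈R , Reach-trans v~x x~r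
    ...     | inj₂ x~b = b , p⊆p∪q R (x∈⁅x⁆ b) , Reach-trans v~x x~b
    b-alone : ∀ {v} → v ∈ R → ¬ Reach ends (⁅ d ⁆ ∪ C) b v
    b-alone {v} v∈R b~v with sep r v r∈R v∈R (Reach-trans (Reach-sym b~r) (Reach-restore b~v))
    ... | refl = ¬r~b′ (Reach-sym b~v)

  transversal-feasible : ∀ {C R p} {lab : Fin n → Fin p} (M : Matroid n) →
                         IsComponentLabeling ends C lab → IsBasis M R → Transversal C R → Feasible M lab
  transversal-feasible {C} {R} {lab = lab} M (onto , component) basis (cover , sep) =
    R , basis , λ c → meets c , once c
    where
    meets : ∀ c → ∃ λ v → v ∈ R × lab v ≡ c
    meets c with onto c
    ... | v , labv≡c with cover v
    ...   | r , r∈R , v~r = r , r∈R , trans (sym (proj₂ (component v r) v~r)) labv≡c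
    once : ∀ c u v → u ∈ R → v ∈ R → lab u ≡ c → lab v ≡ c → u ≡ v
    once c u v u∈R v∈R labu≡c labv≡c = sep u v u∈R v∈R (proj₁ (component u v) (trans labu≡c (sym labv≡c)))

module Tree {n m : ℕ} (ends : Fin m → Fin n × Fin n) (tree : IsTree ends) where

  open Reachability ends

  connected : ∀ {X} → Empty X → ∀ u v → Reach ends X u v
  connected empty u v = Reach-mono (λ {e} e∈X → ⊥-elim (empty (e , e∈X))) (proj₂ tree u v)

  endpoint-side : ∀ {e x y} → Adj (ends e) x y → ∀ v → Reach ends ⁅ e ⁆ v x ⊎ Reach ends ⁅ e ⁆ v y
  endpoint-side {e} {x} xy v with Reach-split ∉⊥ (proj₂ tree v x)
  ... | inj₁ v~x = inj₁ (Reach-mono (p⊆p∪q ⊥) v~x)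
  ... | inj₂ (x′ , _ , x′y′ , v~x′ , _) with Adj-unique xy x′y′
  ...   | inj₁ (refl , _) = inj₁ (Reach-mono (p⊆p∪q ⊥) v~x′)
  ...   | inj₂ (refl , _) = inj₂ (Reach-mono (p⊆p∪q ⊥) v~x′)

  -- Otherwise every vertex reaches x in H − e, and covering-size gives n + 1 ≤ 1 + m.
  edge-separates-ends : ∀ {e x y} → Adj (ends e) x y → ¬ Reach ends ⁅ e ⁆ x y
  edge-separates-ends {e} {x} {y} xy x~y = ℕₚ.<-irrefl refl (begin-strict
      n                   <⟨ ℕₚ.n<1+n n ⟩
      suc n               ≡⟨ ℕₚ.+-comm 1 n ⟩
      n ℕ.+ 1             ≡⟨ cong (n ℕ.+_) (sym (∣⁅x⁆∣≡1 e)) ⟩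
      n ℕ.+ ∣ ⁅ e ⁆ ∣     ≤⟨ covering-size ⁅ e ⁆ ⁅ x ⁆ cover ⟩
      ∣ ⁅ x ⁆ ∣ ℕ.+ m     ≡⟨ cong (ℕ._+ m) (∣⁅x⁆∣≡1 x) ⟩
      suc m               ≡⟨ proj₁ tree ⟩
      n                   ∎)
    where
    open ℕₚ.≤-Reasoning
    cover : Covering ⁅ e ⁆ ⁅ x ⁆
    cover v with endpoint-side xy v
    ... | inj₁ v~x = x , x∈⁅x⁆ x , v~x
    ... | inj₂ v~y = x , x∈⁅x⁆ x , Reach-trans v~y (Reach-sym x~y)

  separated-size : ∀ X A → Separated X A → ∣ A ∣ ℕ.≤ suc ∣ X ∣
  separated-size = insert-induction (λ X → ∀ A → Separated X A → ∣ A ∣ ℕ.≤ suc ∣ X ∣) none-deleted insert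
    where
    none-deleted : ∀ X → Empty X → ∀ A → Separated X A → ∣ A ∣ ℕ.≤ suc ∣ X ∣
    none-deleted X empty A sep =
      ℕₚ.≤-trans (∣p∣≤1 A (λ {u} {v} u∈ v∈ → sep u v u∈ v∈ (connected empty u v))) (ℕ.s≤s ℕ.z≤n)
    insert : ∀ X e → e ∉ X → (∀ A → Separated X A → ∣ A ∣ ℕ.≤ suc ∣ X ∣) →
             ∀ A → Separated (⁅ e ⁆ ∪ X) A → ∣ A ∣ ℕ.≤ suc ∣ ⁅ e ⁆ ∪ X ∣
    insert X e e∉X size A sep with separated-delete e∉X sep
    ... | A′ , _ , sep′ , ∣A∣≤ = ℕₚ.≤-trans ∣A∣≤
      (ℕ.s≤s (subst (∣ A′ ∣ ℕ.≤_) (sym (∣⁅x⁆∪p∣≡1+∣p∣ e∉X)) (size A′ sep′)))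

  -- Holds because the u–v path in a tree is unique.
  Reach-avoiding-each : ∀ Y {u v} → (∀ e → e ∈ Y → Reach ends ⁅ e ⁆ u v) → Reach ends Y u v
  Reach-avoiding-each Y {u} {v} =
    insert-induction (λ Y → (∀ e → e ∈ Y → Reach ends ⁅ e ⁆ u v) → Reach ends Y u v) none-deleted insert Y
    where
    none-deleted : ∀ Y → Empty Y → (∀ e → e ∈ Y → Reach ends ⁅ e ⁆ u v) → Reach ends Y u v
    none-deleted Y empty _ = connected empty u v
    insert : ∀ Y e → e ∉ Y → ((∀ d → d ∈ Y → Reach ends ⁅ d ⁆ u v) → Reach ends Y u v) →
             (∀ d → d ∈ ⁅ e ⁆ ∪ Y → Reach ends ⁅ d ⁆ u v) → Reach ends (⁅ e ⁆ ∪ Y) u v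
    insert Y e e∉Y reach avoids with Reach-split e∉Y (reach (λ d d∈Y → avoids d (q⊆p∪q ⁅ e ⁆ Y d∈Y)))
    ... | inj₁ u~v = u~v
    ... | inj₂ (x , y , xy , u~x , y~v) = ⊥-elim (edge-separates-ends xy
          (Reach-trans (Reach-sym (Reach-mono (p⊆p∪q Y) u~x))
            (Reach-trans (avoids e (p⊆p∪q Y (x∈⁅x⁆ e))) (Reach-sym (Reach-mono (p⊆p∪q Y) y~v)))))

  separating-edge : ∀ Y {u v} → ¬ Reach ends Y u v → ∃ λ e → e ∈ Y × ¬ Reach ends ⁅ e ⁆ u v
  separating-edge Y {u} {v} ¬u~v with any? (λ e → e ∈? Y ×-dec ¬? (Reach? ⁅ e ⁆ u v))
  ... | yes found = found
  ... | no none = ⊥-elim (¬u~v (Reach-avoiding-each Y λ e e∈Y →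
                    decidable-stable (Reach? ⁅ e ⁆ u v) (λ ¬e~ → none (e , e∈Y , ¬e~))))

  crossing-separator : ∀ {U u t} → u ∈ U → t ∉ U → ∃ λ d → Crosses U d × ¬ Reach ends ⁅ d ⁆ u t
  crossing-separator {U} {u} {t} u∈U t∉U with separating-edge crossing ¬u~t
    where
    crossing : Subset m
    crossing = tabulate (does ∘ crosses? U)
    ¬u~t : ¬ Reach ends crossing u t
    ¬u~t u~t = t∉U (Reach-stays-inside (λ d → ∈-tabulate⁺ (crosses? U)) u∈U u~t)
  ... | d , d∈ , ¬u~t = d , ∈-tabulate⁻ (crosses? U) d∈ , ¬u~t

  covering-size-tree : ∀ {X R} → Covering X R → suc ∣ X ∣ ℕ.≤ ∣ R ∣
  covering-size-tree {X} {R} cover = ℕₚ.+-cancelˡ-≤ m (suc ∣ X ∣) ∣ R ∣ (begin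
    m ℕ.+ suc ∣ X ∣  ≡⟨ ℕₚ.+-suc m ∣ X ∣ ⟩
    suc m ℕ.+ ∣ X ∣  ≡⟨ cong (ℕ._+ ∣ X ∣) (proj₁ tree) ⟩
    n ℕ.+ ∣ X ∣      ≤⟨ covering-size X R cover ⟩
    ∣ R ∣ ℕ.+ m      ≡⟨ ℕₚ.+-comm ∣ R ∣ m ⟩
    m ℕ.+ ∣ R ∣      ∎)
    where open ℕₚ.≤-Reasoning

module Greedy {n m : ℕ} (ends : Fin m → Fin n × Fin n) (tree : IsTree ends)
              (M : Matroid n) {r} (rank : HasRank M (suc r))
              (wH : Fin m → ℚ) (wH≥0 : ∀ e → 0ℚ ≤ wH e) where

  open Reachability ends
  open Tree ends tree

  I′-∅ : IndepI' M ends ⊥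
  I′-∅ with nonloop M rank
  ... | x , indx = ⁅ x ⁆ ∪ ⊥ , indx , (λ v → x , p⊆p∪q ⊥ (x∈⁅x⁆ x) , connected ⊥-empty v x) ,
                   λ u v u∈ v∈ _ → trans (only-x u∈) (sym (only-x v∈))
    where
    ⊥-empty : Empty (⊥ {m})
    ⊥-empty (_ , e∈⊥) = ∉⊥ e∈⊥
    only-x : ∀ {u} → u ∈ ⁅ x ⁆ ∪ ⊥ → u ≡ x
    only-x u∈ with x∈p∪q⁻ ⁅ x ⁆ ⊥ u∈
    ... | inj₁ u∈x = x∈⁅y⁆⇒x≡y x u∈x
    ... | inj₂ u∈⊥ = ⊥-elim (∉⊥ u∈⊥)

  GreedyRun⇒I′ : ∀ {C j} → GreedyRun M ends wH C j → IndepI' M ends C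
  GreedyRun⇒I′ start              = I′-∅
  GreedyRun⇒I′ (add _ _ _ I′eC _) = I′eC

  GreedyRun-size : ∀ {C j} → GreedyRun M ends wH C j → ∣ C ∣ ≡ j
  GreedyRun-size start              = ∣⊥∣≡0 m
  GreedyRun-size (add e run e∉C _ _) = trans (∣⁅x⁆∪p∣≡1+∣p∣ e∉C) (cong suc (GreedyRun-size run))

  -- Exchange some b ∈ T into R: either an edge d ∈ D separates b from its representative r, so
  -- deleting d gives b a component of its own, or b replaces r, and R ─ T shrinks.
  augmenting-edge : ∀ {C D R T} → Indep M R → Transversal C R → Indep M T → Separated D T →
                    suc ∣ C ∣ ℕ.< ∣ T ∣ → ∃ λ d → d ∈ D × d ∉ C × IndepI' M ends (⁅ d ⁆ ∪ C)
  augmenting-edge {C} {D} {R₀} {T} indR₀ transR₀ indT sepT ∣C∣+1<∣T∣ =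
    go R₀ indR₀ transR₀ (⊂-wellFounded (R₀ ─ T))
    where
    go : ∀ R → Indep M R → Transversal C R → Acc _⊂_ (R ─ T) →
         ∃ λ d → d ∈ D × d ∉ C × IndepI' M ends (⁅ d ⁆ ∪ C)
    go R indR transR (acc smaller)
      with exchange M indR indT (ℕₚ.≤-<-trans (separated-size C R (proj₂ transR)) ∣C∣+1<∣T∣)
    ... | b , b∈T , b∉R , indbR with proj₁ transR b
    ...   | r , r∈R , b~r with Reach? D r b
    ...     | no ¬r~b with separating-edge D ¬r~b
    ...       | d , d∈D , ¬r~db with transversal-split transR r∈R b~r ¬r~db
    ...         | d∉C , transbR = d , d∈D , d∉C , ⁅ b ⁆ ∪ R , indbR , transbR
    go R indR transR (acc smaller) | b , b∈T , b∉R , indbR | r , r∈R , b~r | yes r~b =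
      go (⁅ b ⁆ ∪ (R - r)) (indep-⊆ M b-swapped-in indbR) (transversal-swap transR r∈R b~r)
         (smaller (exchange-─-⊂ b∈T r∈R r∉T))
      where
      b-swapped-in : ⁅ b ⁆ ∪ (R - r) ⊆ ⁅ b ⁆ ∪ R
      b-swapped-in = ∪-least (p⊆p∪q R) (q⊆p∪q ⁅ b ⁆ R ∘ p─q⊆p R ⁅ r ⁆)
      r∉T : r ∉ T
      r∉T r∈T with sepT r b r∈T b∈T r~b
      ... | refl = b∉R r∈R

  greedy-optimal : ∀ {C j} → GreedyRun M ends wH C j → ∀ D T → Indep M T → Separated D T →
                   suc j ℕ.≤ ∣ T ∣ → sumOver C wH ≤ sumOver D wH
  greedy-optimal start D T _ _ _ = subst (_≤ sumOver D wH) (sym (sumOver-⊥ wH)) (sumOver-nonneg D wH≥0)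
  greedy-optimal (add {C} e run e∉C _ cheapest) D T indT sepT j+2≤∣T∣
    with GreedyRun⇒I′ run
  ... | R , indR , transR
    with augmenting-edge indR transR indT sepT
                         (subst (λ j → suc (suc j) ℕ.≤ ∣ T ∣) (sym (GreedyRun-size run)) j+2≤∣T∣)
  ... | d , d∈D , d∉C , I′dC
    with separated-delete (x∉p-x {p = D}) (subst (λ X → Separated X T) (sym (⁅x⁆∪[p-x]≡p d∈D)) sepT)
  ... | T′ , T′⊆T , sepT′ , ∣T∣≤1+∣T′∣ = begin
    sumOver (⁅ e ⁆ ∪ C) wH        ≡⟨ sumOver-insert wH e∉C ⟩
    wH e + sumOver C wH           ≤⟨ ℚₚ.+-mono-≤ (cheapest d d∉C I′dC) C≤D-d ⟩
    wH d + sumOver (D - d) wH     ≡⟨ sym (sumOver-insert wH (x∉p-x {p = D})) ⟩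
    sumOver (⁅ d ⁆ ∪ (D - d)) wH  ≡⟨ cong (λ X → sumOver X wH) (⁅x⁆∪[p-x]≡p d∈D) ⟩
    sumOver D wH                  ∎
    where
    open ℚₚ.≤-Reasoning
    C≤D-d : sumOver C wH ≤ sumOver (D - d) wH
    C≤D-d = greedy-optimal run (D - d) T′ (indep-⊆ M T′⊆T indT) sepT′
                           (ℕₚ.≤-pred (ℕₚ.≤-trans j+2≤∣T∣ ∣T∣≤1+∣T′∣))

module GomoryHu {n m : ℕ} (ends : Fin m → Fin n × Fin n) (tree : IsTree ends)
                (w : Fin n → Fin n → ℚ) (w≥0 : ∀ i j → 0ℚ ≤ w i j)
                (wH : Fin m → ℚ) (gomoryHu : IsGomoryHu (cut w) ends wH) where

  open Reachability ends
  open Tree ends tree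
  open PartitionCost w

  gomoryHu-edge : ∀ {e x y} → Adj (ends e) x y →
                  (∀ S → x ∈ S → y ∉ S → wH e ≤ cut w S) ×
                  (∀ S → (∀ v → (v ∈ S → Reach ends ⁅ e ⁆ x v) × (Reach ends ⁅ e ⁆ x v → v ∈ S)) →
                     cut w S ≡ wH e)
  gomoryHu-edge {e} {x} {y} xy = gomoryHu x y x≢y e (edge-separates-ends xy) lightest
    where
    x≢y : x ≢ y
    x≢y refl = edge-separates-ends xy here
    lightest : ∀ e′ → OnPath ends e′ x y → wH e ≤ wH e′
    lightest e′ e′-on-path with e′ ≟ e
    ... | yes refl = ℚₚ.≤-refl
    ... | no e′≢e  = ⊥-elim (e′-on-path (step e (e′≢e ∘ sym ∘ x∈⁅y⁆⇒x≡y e′) xy here))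

  crossing-edge-weight : ∀ {U d} → Crosses U d → wH d ≤ cut w U
  crossing-edge-weight (_ , _ , xy , x∈U , y∉U) = proj₁ (gomoryHu-edge xy) _ x∈U y∉U

  fundamentalCut : Fin m → Subset n
  fundamentalCut e = tabulate (does ∘ Reach? ⁅ e ⁆ (proj₁ (ends e)))

  fundamentalCut-weight : ∀ e → cut w (fundamentalCut e) ≡ wH e
  fundamentalCut-weight e = proj₂ (gomoryHu-edge (inj₁ (refl , refl))) (fundamentalCut e)
    (λ v → ∈-tabulate⁻ (Reach? ⁅ e ⁆ (proj₁ (ends e))) , ∈-tabulate⁺ (Reach? ⁅ e ⁆ (proj₁ (ends e))))

  fundamentalCut-separates : ∀ e {i j} → ¬ Reach ends ⁅ e ⁆ i j →
                             (lookup (fundamentalCut e) i xor lookup (fundamentalCut e) j) ≡ true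
  fundamentalCut-separates e {i} {j} ¬i~j
    rewrite lookup∘tabulate (does ∘ Reach? ⁅ e ⁆ (proj₁ (ends e))) i
          | lookup∘tabulate (does ∘ Reach? ⁅ e ⁆ (proj₁ (ends e))) j
    with Reach? ⁅ e ⁆ (proj₁ (ends e)) i | Reach? ⁅ e ⁆ (proj₁ (ends e)) j
  ... | yes a~i | yes a~j = ⊥-elim (¬i~j (Reach-trans (Reach-sym a~i) a~j))
  ... | yes _   | no _    = refl
  ... | no _    | yes _   = refl
  ... | no ¬a~i | no ¬a~j
    with endpoint-side {e} (inj₁ (refl , refl)) i | endpoint-side {e} (inj₁ (refl , refl)) j
  ...   | inj₁ i~a | _        = ⊥-elim (¬a~i (Reach-sym i~a))
  ...   | inj₂ _   | inj₁ j~a = ⊥-elim (¬a~j (Reach-sym j~a))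
  ...   | inj₂ i~b | inj₂ j~b = ⊥-elim (¬i~j (Reach-trans i~b (Reach-sym j~b)))

  crossingWeight≤sumOver-wH : ∀ {C p} {lab : Fin n → Fin p} → IsComponentLabeling ends C lab →
                              crossingWeight lab ≤ sumOver C wH
  crossingWeight≤sumOver-wH {C} {lab = lab} (_ , component) =
    subst (crossingWeight lab ≤_) (sumFin-cong (λ e → cong (keepIf (lookup C e)) (fundamentalCut-weight e)))
      (crossingWeight≤sumOver-cut w≥0 lab C fundamentalCut separated)
    where
    separated : ∀ i j → lab i ≢ lab j →
                ∃ λ e → e ∈ C × (lookup (fundamentalCut e) i xor lookup (fundamentalCut e) j) ≡ true
    separated i j lab≢ with separating-edge C (lab≢ ∘ proj₂ (component i j))
    ... | e , e∈C , ¬i~j = e , e∈C , fundamentalCut-separates e ¬i~j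

  multiway-cut : ∀ {q} (t : Fin q → Fin n) (U : Fin q → Subset n) →
                 (∀ i → t i ∈ U i) → (∀ i j → i ≢ j → t j ∉ U i) →
                 ∃ λ D → (∀ i j → Reach ends D (t i) (t j) → i ≡ j) ×
                         sumOver D wH ≤ sumFin (λ i → cut w (U i))
  multiway-cut {zero} t U _ _ = ⊥ , (λ ()) , ℚₚ.≤-reflexive (sumOver-⊥ wH)
  multiway-cut {suc q} t U t∈U t∉U
    with multiway-cut (t ∘ suc) (U ∘ suc) (t∈U ∘ suc)
                      (λ i j i≢j → t∉U (suc i) (suc j) (i≢j ∘ suc-injective))
  ... | D , sepD , D≤ with any? (λ j → Reach? D (t zero) (t (suc j)))
  ...   | no ¬t₀~ = D , sep ,
    subst (_≤ _) (ℚₚ.+-identityˡ (sumOver D wH)) (ℚₚ.+-mono-≤ (pairSum-nonneg w≥0 _) D≤)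
    where
    sep : ∀ i j → Reach ends D (t i) (t j) → i ≡ j
    sep zero    zero    _     = refl
    sep zero    (suc j) t₀~tⱼ = ⊥-elim (¬t₀~ (j , t₀~tⱼ))
    sep (suc i) zero    tᵢ~t₀ = ⊥-elim (¬t₀~ (i , Reach-sym tᵢ~t₀))
    sep (suc i) (suc j) tᵢ~tⱼ = cong suc (sepD i j tᵢ~tⱼ)
  ...   | yes (j₀ , t₀~tⱼ₀) with crossing-separator (t∈U zero) (t∉U zero (suc j₀) λ ())
  ...     | d , d-crosses , ¬t₀~tⱼ₀ = ⁅ d ⁆ ∪ D , sep ,
    subst (_≤ _) (sym (sumOver-insert wH d∉D)) (ℚₚ.+-mono-≤ (crossing-edge-weight d-crosses) D≤)
    where
    d∉D : d ∉ D
    d∉D d∈D = ¬t₀~tⱼ₀ (Reach-single d∈D t₀~tⱼ₀)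
    -- t zero only reaches t (suc j₀) in H − D, and d separates those two.
    only-j₀ : ∀ {j} → ¬ Reach ends (⁅ d ⁆ ∪ D) (t zero) (t (suc j))
    only-j₀ {j} t₀~tⱼ with sepD j₀ j (Reach-trans (Reach-sym t₀~tⱼ₀) (Reach-restore t₀~tⱼ))
    ... | refl = ¬t₀~tⱼ₀ (Reach-mono (p⊆p∪q D) t₀~tⱼ)
    sep : ∀ i j → Reach ends (⁅ d ⁆ ∪ D) (t i) (t j) → i ≡ j
    sep zero    zero    _     = refl
    sep zero    (suc j) t₀~tⱼ = ⊥-elim (only-j₀ t₀~tⱼ)
    sep (suc i) zero    tᵢ~t₀ = ⊥-elim (only-j₀ (Reach-sym tᵢ~t₀))
    sep (suc i) (suc j) tᵢ~tⱼ = cong suc (sepD i j (Reach-restore tᵢ~tⱼ))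

  feasible-partition-cut : ∀ {p} (M : Matroid n) {lab : Fin n → Fin p} → Feasible M lab →
                           ∃₂ λ D B → IsBasis M B × Separated D B ×
                                      sumOver D wH ≤ crossingWeight lab + crossingWeight lab
  feasible-partition-cut {p} M {lab} (B , basis , parts) =
    let D , separates-terminals , D≤ = multiway-cut terminal (part lab) terminal∈part terminal∉part
    in D , B , basis , separated-basis separates-terminals ,
       subst (sumOver D wH ≤_) (sumFin-cut-part lab) D≤
    where
    terminal : Fin p → Fin n
    terminal c = proj₁ (proj₁ (parts c))
    terminal∈B : ∀ c → terminal c ∈ B
    terminal∈B c = proj₁ (proj₂ (proj₁ (parts c)))
    lab-terminal : ∀ c → lab (terminal c) ≡ c
    lab-terminal c = proj₂ (proj₂ (proj₁ (parts c)))
    terminal-unique : ∀ {u} → u ∈ B → u ≡ terminal (lab u)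
    terminal-unique {u} u∈B =
      proj₂ (parts (lab u)) u (terminal (lab u)) u∈B (terminal∈B (lab u)) refl (lab-terminal (lab u))
    terminal∈part : ∀ c → terminal c ∈ part lab c
    terminal∈part c = ∈-tabulate⁺ (λ v → lab v ≟ c) (lab-terminal c)
    terminal∉part : ∀ c c′ → c ≢ c′ → terminal c′ ∉ part lab c
    terminal∉part c c′ c≢c′ t∈ = c≢c′ (trans (sym (∈-tabulate⁻ (λ v → lab v ≟ c) t∈)) (lab-terminal c′))
    separated-basis : ∀ {D} → (∀ c c′ → Reach ends D (terminal c) (terminal c′) → c ≡ c′) → Separated D B
    separated-basis {D} separates u v u∈B v∈B u~v = begin
      u                   ≡⟨ terminal-unique u∈B ⟩
      terminal (lab u)    ≡⟨ cong terminal (separates (lab u) (lab v)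
                               (subst₂ (Reach ends D) (terminal-unique u∈B) (terminal-unique v∈B) u~v)) ⟩
      terminal (lab v)    ≡⟨ sym (terminal-unique v∈B) ⟩
      v                   ∎
      where open ≡-Reasoning

four-thirds-bound : ∀ {W x d} → x ≤ W → x ≤ d + d → W + x ≤ ((+ 4) / 3) * (W + d)
four-thirds-bound {W} {x} {d} x≤W x≤2d = begin
  W + x                               ≡⟨ cong (λ y → W + y) (thirds x) ⟩
  W + third * (x + x + x)             ≤⟨ ℚₚ.+-monoʳ-≤ W (ℚₚ.*-monoˡ-≤-nonNeg third
                                           (ℚₚ.+-mono-≤ (ℚₚ.+-mono-≤ x≤W x≤2d) x≤2d)) ⟩
  W + third * (W + (d + d) + (d + d)) ≡⟨ collect W d ⟩
  ((+ 4) / 3) * (W + d)               ∎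
  where
  open ℚₚ.≤-Reasoning
  open +-*-Solver
  third : ℚ
  third = (+ 1) / 3
  thirds : ∀ x → x ≡ third * (x + x + x)
  thirds = solve 1 (λ x → x := con third :* (x :+ x :+ x)) refl
  collect : ∀ W d → W + third * (W + (d + d) + (d + d)) ≡ ((+ 4) / 3) * (W + d)
  collect = solve 2 (λ W d → W :+ con third :* (W :+ (d :+ d) :+ (d :+ d))
                           := con ((+ 4) / 3) :* (W :+ d)) refl

-- The symmetry hypothesis on w is unused: pairSum only reads w i j for i < j.
theorem5 : (n : ℕ) (w : Fin n → Fin n → ℚ) →
             (∀ i j → w i j ≡ w j i) → (∀ i j → 0ℚ ≤ w i j) →
             (M : Matroid n) (k : ℕ) → HasRank M (suc k) →
             (m : ℕ) (ends : Fin m → Fin n × Fin n) (wH : Fin m → ℚ) →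
             IsTree ends → (∀ e → 0ℚ ≤ wH e) → IsGomoryHu (cut w) ends wH →
             (C : Subset m) → GreedyRun M ends wH C k →
             (p : ℕ) (lab : Fin n → Fin p) → IsComponentLabeling ends C lab →
             Feasible M lab ×
             (∀ (p' : ℕ) (lab' : Fin n → Fin p') → IsPartition lab' → Feasible M lab' →
                partCost (coverage w) lab ≤ ((+ 4) / 3) * partCost (coverage w) lab')
theorem5 n w _ w≥0 M k rank m ends wH tree wH≥0 gomoryHu C run p lab labeling = feasible , bound
  where
  open PartitionCost w
  open Reachability ends
  open Tree ends tree
  open Greedy ends tree M rank wH wH≥0
  open GomoryHu ends tree w w≥0 wH gomoryHu

  feasible : Feasible M lab
  feasible with GreedyRun⇒I′ run
  ... | R , indR , transR =
    transversal-feasible M labeling (large-independent-is-basis M rank indR k+1≤∣R∣) transR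
    where
    k+1≤∣R∣ : suc k ℕ.≤ ∣ R ∣
    k+1≤∣R∣ = subst (λ j → suc j ℕ.≤ ∣ R ∣) (GreedyRun-size run) (covering-size-tree (proj₁ transR))

  bound : ∀ p′ (lab′ : Fin n → Fin p′) → IsPartition lab′ → Feasible M lab′ →
          partCost (coverage w) lab ≤ ((+ 4) / 3) * partCost (coverage w) lab′
  bound p′ lab′ _ feasible′ with feasible-partition-cut M feasible′
  ... | D , B , basisB , sepB , D≤ =
    subst₂ (λ a b → a ≤ ((+ 4) / 3) * b) (sym (partCost-coverage lab)) (sym (partCost-coverage lab′))
      (four-thirds-bound (crossingWeight≤totalWeight w≥0 lab) (begin
        crossingWeight lab                         ≤⟨ crossingWeight≤sumOver-wH labeling ⟩
        sumOver C wH                               ≤⟨ greedy-optimal run D B (proj₁ basisB) sepB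
                                                        (basis-size M rank basisB) ⟩
        sumOver D wH                               ≤⟨ D≤ ⟩
        crossingWeight lab′ + crossingWeight lab′  ∎))
    where open ℚₚ.≤-Reasoning
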